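{- Let $\hat A$ and $\hat B$ be change actions, and suppose that either (1) $\hat B$ is transitive, or (2) the change action $\hat{\Delta B}=(\Delta B,\Delta B,+_B,+_B,0_B)$ is transitive and $\oplus_B:B\times\Delta B\to B$ is differentiable with respect to the product change action $\hat B\times\hat{\Delta B}$. Let $D$ be the set of differentiable functions from $\hat A$ to $\hat B$. Then the pointwise functional change action $(D,\ A\to\Delta B,\ \oplus_\to,\ +_\to,\ 0_\to)$, where $(f\oplus_\to\delta f)(x)=f(x)\oplus_B\delta f(x)$, $(\delta f+_\to\delta g)(x)=\delta f(x)+_B\delta g(x)$, $0_\to(x)=0_B$, is well defined; in particular for every differentiable $f:A\to B$ and every function $\delta f:A\to\Delta B$, the function $f\oplus_\to\delta f$ is differentiable.
   Context: A change action $\hat A=(A,\Delta A,\oplus,+,0)$ is a set $A$, a monoid $(\Delta A,+,0)$ and a monoid action $\oplus:A\times\Delta A\to A$ ($a\oplus 0=a$, $a\oplus(\delta_1+\delta_2)=(a\oplus\delta_1)\oplus\delta_2$). It is transitive if for all $a,b$ there is $\delta$ with $a\oplus\delta=b$. A function $f:A\to B$ is differentiable if there is $\partial f:A\times\Delta A\to\Delta B$ with $f(a\oplus_A\delta)=f(a)\oplus_B\partial f(a,\delta)$. The product change action $\hat A\times\hat B$ has base $A\times B$, change set $\Delta A\times\Delta B$ and componentwise monoid and action. -}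

module Defs where

open import Level using (Level; _⊔_)
open import Data.Product using (Σ; _×_; _,_; proj₁; proj₂)
open import Relation.Binary.PropositionalEquality using (_≡_)
open import Algebra.Bundles using (Monoid)

record ChangeAction (a : Level) : Set (Level.suc a) where
  field
    Base   : Set a
    Δ      : Set a
    _⊕_    : Base → Δ → Base
    _+_    : Δ → Δ → Δ
    0Δ     : Δ
    +-assoc   : ∀ x y z → (x + y) + z ≡ x + (y + z)
    +-identityˡ : ∀ x → 0Δ + x ≡ x
    +-identityʳ : ∀ x → x + 0Δ ≡ x
    ⊕-identity : ∀ p → p ⊕ 0Δ ≡ p
    ⊕-act      : ∀ p δ₁ δ₂ → p ⊕ (δ₁ + δ₂) ≡ (p ⊕ δ₁) ⊕ δ₂

open ChangeAction public

Transitive : ∀ {a} → ChangeAction a → Set a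
Transitive 𝐀 = ∀ (x y : Base 𝐀) → Σ (Δ 𝐀) λ δ → _⊕_ 𝐀 x δ ≡ y

Differentiable : ∀ {a b} (𝐀 : ChangeAction a) (𝐁 : ChangeAction b) →
                 (Base 𝐀 → Base 𝐁) → Set (a ⊔ b)
Differentiable 𝐀 𝐁 f =
  Σ (Base 𝐀 → Δ 𝐀 → Δ 𝐁) λ ∂f →
    ∀ x δ → f (_⊕_ 𝐀 x δ) ≡ _⊕_ 𝐁 (f x) (∂f x δ)

_×CA_ : ∀ {a} → ChangeAction a → ChangeAction a → ChangeAction a
𝐀 ×CA 𝐁 = record
  { Base = Base 𝐀 × Base 𝐁
  ; Δ = Δ 𝐀 × Δ 𝐁
  ; _⊕_ = λ { (x , y) (δ , ε) → (_⊕_ 𝐀 x δ , _⊕_ 𝐁 y ε) }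
  ; _+_ = λ { (δ , ε) (δ' , ε') → (_+_ 𝐀 δ δ' , _+_ 𝐁 ε ε') }
  ; 0Δ = (0Δ 𝐀 , 0Δ 𝐁)
  ; +-assoc = λ { (a₁ , b₁) (a₂ , b₂) (a₃ , b₃) →
      pair≡ (+-assoc 𝐀 a₁ a₂ a₃) (+-assoc 𝐁 b₁ b₂ b₃) }
  ; +-identityˡ = λ { (x , y) → pair≡ (+-identityˡ 𝐀 x) (+-identityˡ 𝐁 y) }
  ; +-identityʳ = λ { (x , y) → pair≡ (+-identityʳ 𝐀 x) (+-identityʳ 𝐁 y) }
  ; ⊕-identity = λ { (x , y) → pair≡ (⊕-identity 𝐀 x) (⊕-identity 𝐁 y) }
  ; ⊕-act = λ { (x , y) (δ , ε) (δ' , ε') →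
      pair≡ (⊕-act 𝐀 x δ δ') (⊕-act 𝐁 y ε ε') }
  }
  where
  open import Relation.Binary.PropositionalEquality using (cong₂)
  pair≡ : ∀ {a b} {A : Set a} {B : Set b} {x x' : A} {y y' : B} →
          x ≡ x' → y ≡ y' → (x , y) ≡ (x' , y')
  pair≡ p q = cong₂ _,_ p q

ΔCA : ∀ {b} → ChangeAction b → ChangeAction b
ΔCA 𝐁 = record
  { Base = Δ 𝐁 ; Δ = Δ 𝐁 ; _⊕_ = _+_ 𝐁 ; _+_ = _+_ 𝐁 ; 0Δ = 0Δ 𝐁
  ; +-assoc = +-assoc 𝐁 ; +-identityˡ = +-identityˡ 𝐁
  ; +-identityʳ = +-identityʳ 𝐁 ; ⊕-identity = +-identityʳ 𝐁
  ; ⊕-act = λ x y z → Relation.Binary.PropositionalEquality.sym (+-assoc 𝐁 x y z) }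
  where import Relation.Binary.PropositionalEquality

Hyp : ∀ {b} → ChangeAction b → Set b
Hyp 𝐁 = Transitive 𝐁
      ⊎ (Transitive (ΔCA 𝐁) ×
         Differentiable (𝐁 ×CA ΔCA 𝐁) 𝐁 (λ p → _⊕_ 𝐁 (proj₁ p) (proj₂ p)))
  where open import Data.Sum using (_⊎_)

D : ∀ {a} (𝐀 𝐁 : ChangeAction a) → Set a
D 𝐀 𝐁 = Σ (Base 𝐀 → Base 𝐁) (Differentiable 𝐀 𝐁)

_⊕→_ : ∀ {a} {𝐀 𝐁 : ChangeAction a} →
       (Base 𝐀 → Base 𝐁) → (Base 𝐀 → Δ 𝐁) → (Base 𝐀 → Base 𝐁)
_⊕→_ {𝐁 = 𝐁} f δf x = _⊕_ 𝐁 (f x) (δf x)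

_+→_ : ∀ {a} {𝐀 𝐁 : ChangeAction a} →
       (Base 𝐀 → Δ 𝐁) → (Base 𝐀 → Δ 𝐁) → (Base 𝐀 → Δ 𝐁)
_+→_ {𝐁 = 𝐁} δf δg x = _+_ 𝐁 (δf x) (δg x)

0→ : ∀ {a} {𝐀 𝐁 : ChangeAction a} → Base 𝐀 → Δ 𝐁
0→ {𝐁 = 𝐁} x = 0Δ 𝐁

-- If B is transitive, every function into B is differentiable: a derivative
-- is any change taking f x to f (x ⊕ δ).  Otherwise f ⊕→ δf factors as the
-- differentiable ⊕_B after the pairing x ↦ (f x , δf x); δf is
-- differentiable because ΔB is transitive, so the chain rule applies.
module Submission where

open import Defs
open import Level using (Level)
open import Data.Product using (Σ; _×_; _,_; proj₁; proj₂)
open import Data.Sum using (inj₁; inj₂)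
open import Function using (_∘_)
open import Relation.Binary.PropositionalEquality
  using (_≡_; sym; trans; cong; cong₂)

private
  variable
    a b c : Level

transitive⇒differentiable : (𝐀 : ChangeAction a) (𝐁 : ChangeAction b) →
  Transitive 𝐁 → (f : Base 𝐀 → Base 𝐁) → Differentiable 𝐀 𝐁 f
transitive⇒differentiable 𝐀 𝐁 reach f =
    (λ x δ → proj₁ (reach (f x) (f (_⊕_ 𝐀 x δ))))
  , (λ x δ → sym (proj₂ (reach (f x) (f (_⊕_ 𝐀 x δ)))))

differentiable-∘ : (𝐀 : ChangeAction a) (𝐁 : ChangeAction b)
  (𝐂 : ChangeAction c) {g : Base 𝐁 → Base 𝐂} {f : Base 𝐀 → Base 𝐁} →
  Differentiable 𝐁 𝐂 g → Differentiable 𝐀 𝐁 f →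
  Differentiable 𝐀 𝐂 (g ∘ f)
differentiable-∘ 𝐀 𝐁 𝐂 {g} {f} (∂g , g-rule) (∂f , f-rule) =
    (λ x δ → ∂g (f x) (∂f x δ))
  , (λ x δ → trans (cong g (f-rule x δ))
                   (g-rule (f x) (∂f x δ)))

differentiable-⟨,⟩ : (𝐀 : ChangeAction a) (𝐁 𝐂 : ChangeAction b)
  {f : Base 𝐀 → Base 𝐁} {g : Base 𝐀 → Base 𝐂} →
  Differentiable 𝐀 𝐁 f → Differentiable 𝐀 𝐂 g →
  Differentiable 𝐀 (𝐁 ×CA 𝐂) (λ x → f x , g x)
differentiable-⟨,⟩ 𝐀 𝐁 𝐂 (∂f , f-rule) (∂g , g-rule) =
    (λ x δ → ∂f x δ , ∂g x δ)
  , (λ x δ → cong₂ _,_ (f-rule x δ) (g-rule x δ))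

pointwise-⊕-differentiable : (𝐀 𝐁 : ChangeAction a) → Hyp 𝐁 →
  (f : D 𝐀 𝐁) (δf : Base 𝐀 → Δ 𝐁) →
  Differentiable 𝐀 𝐁 (_⊕→_ {𝐀 = 𝐀} {𝐁 = 𝐁} (proj₁ f) δf)
pointwise-⊕-differentiable 𝐀 𝐁 (inj₁ reach) (f , _) δf =
  transitive⇒differentiable 𝐀 𝐁 reach (_⊕→_ {𝐀 = 𝐀} {𝐁 = 𝐁} f δf)
pointwise-⊕-differentiable 𝐀 𝐁 (inj₂ (reachΔ , ⊕-diff)) (f , f-diff) δf =
  differentiable-∘ 𝐀 (𝐁 ×CA ΔCA 𝐁) 𝐁 ⊕-diff
    (differentiable-⟨,⟩ 𝐀 𝐁 (ΔCA 𝐁) f-diff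
      (transitive⇒differentiable 𝐀 (ΔCA 𝐁) reachΔ δf))

mainTheorem13 : ∀ {ℓ : Level} (𝐀 𝐁 : ChangeAction ℓ) → Hyp 𝐁 →
    ((f : D 𝐀 𝐁) (δf : Base 𝐀 → Δ 𝐁) →
        Differentiable 𝐀 𝐁 (_⊕→_ {𝐀 = 𝐀} {𝐁 = 𝐁} (proj₁ f) δf))
    × ((f : D 𝐀 𝐁) (x : Base 𝐀) →
        _⊕→_ {𝐀 = 𝐀} {𝐁 = 𝐁} (proj₁ f) (0→ {𝐀 = 𝐀} {𝐁 = 𝐁}) x ≡ proj₁ f x)
    × ((f : D 𝐀 𝐁) (δf δg : Base 𝐀 → Δ 𝐁) (x : Base 𝐀) →
        _⊕→_ {𝐀 = 𝐀} {𝐁 = 𝐁} (proj₁ f) (_+→_ {𝐀 = 𝐀} {𝐁 = 𝐁} δf δg) x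
          ≡ _⊕→_ {𝐀 = 𝐀} {𝐁 = 𝐁} (_⊕→_ {𝐀 = 𝐀} {𝐁 = 𝐁} (proj₁ f) δf) δg x)
    × ((δf δg δh : Base 𝐀 → Δ 𝐁) (x : Base 𝐀) →
        _+→_ {𝐀 = 𝐀} {𝐁 = 𝐁} (_+→_ {𝐀 = 𝐀} {𝐁 = 𝐁} δf δg) δh x
          ≡ _+→_ {𝐀 = 𝐀} {𝐁 = 𝐁} δf (_+→_ {𝐀 = 𝐀} {𝐁 = 𝐁} δg δh) x)
    × ((δf : Base 𝐀 → Δ 𝐁) (x : Base 𝐀) →
        _+→_ {𝐀 = 𝐀} {𝐁 = 𝐁} (0→ {𝐀 = 𝐀} {𝐁 = 𝐁}) δf x ≡ δf x)
    × ((δf : Base 𝐀 → Δ 𝐁) (x : Base 𝐀) →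
        _+→_ {𝐀 = 𝐀} {𝐁 = 𝐁} δf (0→ {𝐀 = 𝐀} {𝐁 = 𝐁}) x ≡ δf x)
mainTheorem13 𝐀 𝐁 hyp =
    pointwise-⊕-differentiable 𝐀 𝐁 hyp
  , (λ f x → ⊕-identity 𝐁 (proj₁ f x))
  , (λ f δf δg x → ⊕-act 𝐁 (proj₁ f x) (δf x) (δg x))
  , (λ δf δg δh x → +-assoc 𝐁 (δf x) (δg x) (δh x))
  , (λ δf x → +-identityˡ 𝐁 (δf x))
  , (λ δf x → +-identityʳ 𝐁 (δf x))
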